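{- If $T$ is a finite tree on at least three vertices with $\ell$ leaves, then $B(T) = \ell$.
   Context: Bodyguards and Presidents is a two-player game on a finite simple graph $G$. One player controls a set of tokens called bodyguards, the other a single token called the president. First all bodyguards are placed on vertices (several may share a vertex), then the president is placed. The players then alternate turns, bodyguards first; on a player's turn, each token they control either moves to an adjacent vertex or stays put. The president is surrounded if every vertex of the open neighbourhood of the president's vertex is occupied by a bodyguard. The bodyguards win if there is a finite time after which, at the end of every bodyguard turn, the president is surrounded; otherwise the president wins. The bodyguard number $B(G)$ is the minimum number of bodyguards that guarantees a win for the bodyguards on $G$. -}

module Defs where

open import Data.Nat using (ℕ; zero; suc; _+_; _≤_; _<_; _≡ᵇ_)
open import Data.Bool using (Bool; true; false; if_then_else_)
open import Data.Fin using (Fin)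
open import Data.List using (List; []; _∷_; _++_; length; map; allFin)
open import Data.Nat.ListAction using (sum)
open import Data.List.Relation.Unary.Unique.Propositional using (Unique)
open import Data.Product using (Σ; ∃; _×_; _,_; proj₁; proj₂)
open import Data.Sum using (_⊎_)
open import Data.Unit using (⊤)
open import Relation.Nullary using (¬_)
open import Relation.Binary.PropositionalEquality using (_≡_)

record SimpleGraph (n : ℕ) : Set where
  field
    adj    : Fin n → Fin n → Bool
    sym    : ∀ u v → adj u v ≡ adj v u
    irrefl : ∀ v → adj v v ≡ false

module _ {n : ℕ} (G : SimpleGraph n) where
  open SimpleGraph G

  Adj : Fin n → Fin n → Set
  Adj u v = adj u v ≡ true

  degree : Fin n → ℕ
  degree u = sum (map (λ v → if adj u v then 1 else 0) (allFin n))

  numLeaves : ℕ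
  numLeaves = sum (map (λ v → if degree v ≡ᵇ 1 then 1 else 0) (allFin n))

  data Walk : Fin n → Fin n → Set where
    here : ∀ {u} → Walk u u
    step : ∀ {u w v} → Adj u w → Walk w v → Walk u v

  Connected : Set
  Connected = ∀ u v → Walk u v

  IsPath : List (Fin n) → Set
  IsPath []           = ⊤
  IsPath (x ∷ [])     = ⊤
  IsPath (x ∷ y ∷ xs) = Adj x y × IsPath (y ∷ xs)

  HasCycle : Set
  HasCycle = Σ (Fin n) λ x → Σ (List (Fin n)) λ ys →
    2 ≤ length ys × Unique (x ∷ ys) × IsPath (x ∷ ys ++ x ∷ [])

  IsTree : Set
  IsTree = Connected × ¬ HasCycle

  Conf : ℕ → Set
  Conf k = Fin k → Fin n

  LegalStep : Fin n → Fin n → Set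
  LegalStep u v = u ≡ v ⊎ Adj u v

  LegalConfStep : ∀ {k} → Conf k → Conf k → Set
  LegalConfStep c c' = ∀ i → LegalStep (c i) (c' i)

  Surrounded : ∀ {k} → Conf k → Fin n → Set
  Surrounded {k} c v = ∀ u → Adj v u → ∃ λ (i : Fin k) → c i ≡ u

  -- History: list of rounds (c_t , p_t), most recent first.
  History : ℕ → Set
  History k = List (Conf k × Fin n)

  record BStrategy (k : ℕ) : Set where
    field
      start : Conf k
      move  : (c : Conf k) (p : Fin n) (h : History k) → Conf k
      legal : ∀ c p h → LegalConfStep c (move c p h)

  record PStrategy (k : ℕ) : Set where
    field
      place : Conf k → Fin n
      move  : (c : Conf k) (p : Fin n) (h : History k) (c' : Conf k) → Fin n
      legal : ∀ c p h c' → LegalStep p (move c p h c')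

  playState : ∀ {k} → BStrategy k → PStrategy k → ℕ → Conf k × Fin n × History k
  playState σ τ zero =
    let c₀ = BStrategy.start σ in c₀ , PStrategy.place τ c₀ , []
  playState σ τ (suc t) with playState σ τ t
  ... | c , p , h =
    let c' = BStrategy.move σ c p h
        p' = PStrategy.move τ c p h c'
    in c' , p' , (c , p) ∷ h

  bodyguardsAt : ∀ {k} → BStrategy k → PStrategy k → ℕ → Conf k
  bodyguardsAt σ τ t = proj₁ (playState σ τ t)

  presidentAt : ∀ {k} → BStrategy k → PStrategy k → ℕ → Fin n
  presidentAt σ τ t = proj₁ (proj₂ (playState σ τ t))

  -- Bodyguards win the play if from some time on, at the end of every
  -- bodyguard turn (bodyguards just moved to c_{t+1}, president at p_t),
  -- the president is surrounded.
  BodyguardsWinPlay : ∀ {k} → BStrategy k → PStrategy k → Set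
  BodyguardsWinPlay σ τ = ∃ λ T → ∀ t → T ≤ t →
    Surrounded (bodyguardsAt σ τ (suc t)) (presidentAt σ τ t)

  BodyguardsWin : ℕ → Set
  BodyguardsWin k = Σ (BStrategy k) λ σ → ∀ (τ : PStrategy k) → BodyguardsWinPlay σ τ

  IsBodyguardNumber : ℕ → Set
  IsBodyguardNumber m = BodyguardsWin m × (∀ k → k < m → ¬ BodyguardsWin k)

-- Upper bound: give every leaf x its own bodyguard, starting on x.  It walks
-- towards the president; while it is not yet next to him it stays on the path
-- from x to the president and gets one step further from x in every round, so
-- after boundedly many rounds it stands on the president's neighbour in the
-- direction of x, and it can keep that position whatever the president does.
-- Every branch at the president contains a leaf, so then all his neighbours are
-- occupied.
--
-- Lower bound: with fewer bodyguards than leaves, some branch at any non-leaf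
-- vertex contains more leaves than bodyguards, and the president escapes into
-- it.  If he is surrounded at a after escaping into the branch through q, the
-- bodyguards now in the branches at q other than a all came from the branch at a
-- through q, so by double counting one of those smaller branches is again
-- deficient (q itself is no leaf: its branch would contain a single, occupied,
-- leaf).  Fleeing forward for ever through ever smaller branches is impossible.
-- Three vertices ensure that a president starting at a leaf moves to a non-leaf.

module Submission where

open import Defs
import Algebra.Properties.CommutativeMonoid.Sum as Sum
open import Data.Bool using (true; false; if_then_else_)
import Data.Bool as Bool
open import Data.Empty using (⊥; ⊥-elim)
open import Data.Fin using (Fin; zero; suc; fromℕ<)
import Data.Fin.Properties as Fin
open import Data.List using (List; []; _∷_; _++_; map; allFin; tabulate; length; filter; lookup)
open import Data.List.Membership.Propositional.Properties using (∈-filter⁺; ∈-allFin)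
open import Data.List.Properties using (map-tabulate; length-++)
open import Data.List.Relation.Unary.All using (All; []; _∷_)
import Data.List.Relation.Unary.All as All using (map)
import Data.List.Relation.Unary.All.Properties as All using (++⁺)
open import Data.List.Relation.Unary.AllPairs using ([]; _∷_)
import Data.List.Relation.Unary.AllPairs.Properties as AllPairs using (++⁺)
import Data.List.Relation.Unary.Any as Any using (index)
import Data.List.Relation.Unary.Any.Properties as Any using (lookup-index)
open import Data.List.Relation.Unary.Unique.Propositional using (Unique)
open import Data.Nat using (ℕ; zero; suc; _+_; _∸_; _≤_; _<_; z≤n; s≤s; _≟_; _≤?_; _<?_)
import Data.Nat.ListAction as List
open import Data.Nat.Properties
open import Data.Product using (∃; _×_; _,_; proj₁; proj₂)
open import Data.Sum using (_⊎_; inj₁; inj₂; [_,_]′)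
open import Data.Unit using (⊤; tt)
open import Function using (_∘_; id)
open import Level using (Level; 0ℓ)
open import Relation.Binary using (tri<; tri≈; tri>)
open import Relation.Binary.PropositionalEquality
open import Relation.Nullary using (¬_; Dec; yes; no; does; ¬?; _×-dec_; _⊎-dec_)
open import Relation.Nullary.Decidable using (decidable-stable)
open import Relation.Unary using (Pred; Decidable)

open Sum +-0-commutativeMonoid using (sum; sum-syntax; sum-cong-≗; sum-replicate-zero; ∑-comm)

private
  variable
    p q : Level
    m : ℕ
    P : Pred (Fin m) p
    Q : Pred (Fin m) q

𝟙 : {P : Set p} → Dec P → ℕ
𝟙 P? = if does P? then 1 else 0

𝟙-mono : {P : Set p} {Q : Set q} (P? : Dec P) (Q? : Dec Q) → (P → Q) → 𝟙 P? ≤ 𝟙 Q?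
𝟙-mono (yes x) (yes _)  P→Q = ≤-refl
𝟙-mono (yes x) (no ¬Q)  P→Q = ⊥-elim (¬Q (P→Q x))
𝟙-mono (no _)  _        P→Q = z≤n

𝟙-no : {P : Set p} (P? : Dec P) → ¬ P → 𝟙 P? ≡ 0
𝟙-no (yes x) ¬P = ⊥-elim (¬P x)
𝟙-no (no _)  ¬P = refl

∑-mono-≤ : ∀ {m} {f g : Fin m → ℕ} → (∀ i → f i ≤ g i) → sum f ≤ sum g
∑-mono-≤ {zero}  f≤g = z≤n
∑-mono-≤ {suc m} f≤g = +-mono-≤ (f≤g zero) (∑-mono-≤ (f≤g ∘ suc))

∑-mono-< : {f g : Fin m → ℕ} → (∀ i → f i ≤ g i) → ∀ j → f j < g j → sum f < sum g
∑-mono-< f≤g zero    fj<gj = +-mono-<-≤ fj<gj (∑-mono-≤ (f≤g ∘ suc))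
∑-mono-< f≤g (suc j) fj<gj = +-mono-≤-< (f≤g zero) (∑-mono-< (f≤g ∘ suc) j fj<gj)

term≤∑ : (f : Fin m → ℕ) → ∀ i → f i ≤ sum f
term≤∑ f zero    = m≤m+n _ _
term≤∑ f (suc i) = ≤-trans (term≤∑ (f ∘ suc) i) (m≤n+m _ _)

sum-map-allFin : (f : Fin m → ℕ) → List.sum (map f (allFin m)) ≡ sum f
sum-map-allFin f = trans (cong List.sum (map-tabulate id f)) (sum-tabulate f)
  where
  sum-tabulate : ∀ {m} (f : Fin m → ℕ) → List.sum (tabulate f) ≡ sum f
  sum-tabulate {zero}  f = refl
  sum-tabulate {suc m} f = cong (f zero +_) (sum-tabulate (f ∘ suc))

length-filter : ∀ {a} {A : Set a} {P : Pred A p} (P? : Decidable P) (xs : List A) →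
  length (filter P? xs) ≡ List.sum (map (𝟙 ∘ P?) xs)
length-filter P? []       = refl
length-filter P? (x ∷ xs) with does (P? x)
... | true  = cong suc (length-filter P? xs)
... | false = length-filter P? xs

count : Decidable P → ℕ
count P? = sum (𝟙 ∘ P?)

count-mono : (P? : Decidable P) (Q? : Decidable Q) → (∀ {i} → P i → Q i) → count P? ≤ count Q?
count-mono P? Q? P⊆Q = ∑-mono-≤ (λ i → 𝟙-mono (P? i) (Q? i) P⊆Q)

count-mono-< : (P? : Decidable P) (Q? : Decidable Q) → (∀ {i} → P i → Q i) →
  ∀ {j} → Q j → ¬ P j → count P? < count Q?
count-mono-< {P = P} {Q = Q} P? Q? P⊆Q {j} Qj ¬Pj =
  ∑-mono-< (λ i → 𝟙-mono (P? i) (Q? i) P⊆Q) j (𝟙-< (P? j) (Q? j))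
  where
  𝟙-< : (Pj? : Dec (P j)) (Qj? : Dec (Q j)) → 𝟙 Pj? < 𝟙 Qj?
  𝟙-< (yes Pj) _        = ⊥-elim (¬Pj Pj)
  𝟙-< (no _)   (yes _)  = s≤s z≤n
  𝟙-< (no _)   (no ¬Qj) = ⊥-elim (¬Qj Qj)

count-none : ∀ {m} {P : Pred (Fin m) p} (P? : Decidable P) → (∀ i → ¬ P i) → count P? ≡ 0
count-none {m = m} P? ¬P = n≤0⇒n≡0
  (≤-trans (∑-mono-≤ (λ i → ≤-reflexive (𝟙-no (P? i) (¬P i)))) (≤-reflexive (sum-replicate-zero m)))

count-pos : (P? : Decidable P) → ∀ {i} → P i → 1 ≤ count P?
count-pos P? {i} Pi = ≤-trans (𝟙-mono (yes Pi) (P? i) id) (term≤∑ (𝟙 ∘ P?) i)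

count-≥2 : (P? : Decidable P) → ∀ {i j} → P i → P j → i ≢ j → 2 ≤ count P?
count-≥2 {P = P} P? {i} {j} Pi Pj i≢j =
  ≤-trans (s≤s (count-pos P∖j? (Pi , i≢j))) (count-mono-< P∖j? P? proj₁ Pj (λ (_ , j≢j) → j≢j refl))
  where
  P∖j? : Decidable (λ x → P x × x ≢ j)
  P∖j? x = P? x ×-dec ¬? (x Fin.≟ j)

count-≤ : ∀ {m} {P : Pred (Fin m) p} (P? : Decidable P) → count P? ≤ m
count-≤ {m = zero}  P? = z≤n
count-≤ {m = suc m} P? = +-mono-≤ (𝟙≤1 (P? zero)) (count-≤ (P? ∘ suc))
  where
  𝟙≤1 : {P : Set p} (P? : Dec P) → 𝟙 P? ≤ 1
  𝟙≤1 (yes _) = ≤-refl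
  𝟙≤1 (no _)  = z≤n

count-≤-1 : ∀ {m} {P : Pred (Fin m) p} (P? : Decidable P) → (∀ {i j} → P i → P j → i ≡ j) → count P? ≤ 1
count-≤-1 {m = zero}  P? unique = z≤n
count-≤-1 {m = suc m} P? unique with P? zero
... | yes P0 = ≤-reflexive (cong suc (count-none (P? ∘ suc) (λ i Pi → 0≢suc (unique P0 Pi))))
  where
  0≢suc : ∀ {i : Fin m} → zero ≢ suc i
  0≢suc ()
... | no _   = count-≤-1 (P? ∘ suc) (λ Pi Pj → Fin.suc-injective (unique Pi Pj))

count-≤-𝟙 : {Q : Set q} (P? : Decidable P) (Q? : Dec Q) →
  (∀ {i j} → P i → P j → i ≡ j) → (∀ {i} → P i → Q) → count P? ≤ 𝟙 Q?
count-≤-𝟙 P? (yes _) unique P⇒Q = count-≤-1 P? unique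
count-≤-𝟙 P? (no ¬Q) unique P⇒Q = ≤-reflexive (count-none P? (λ i Pi → ¬Q (P⇒Q Pi)))

𝟙-≤-count : {Q : Set q} (Q? : Dec Q) (P? : Decidable P) → (Q → ∃ P) → 𝟙 Q? ≤ count P?
𝟙-≤-count (yes x) P? Q⇒∃P = count-pos P? (proj₂ (Q⇒∃P x))
𝟙-≤-count (no _)  P? Q⇒∃P = z≤n

double-counting :
  ∀ {m k l} {P : Pred (Fin m) 0ℓ} {Q : Pred (Fin k) 0ℓ} {J : Pred (Fin l) 0ℓ}
  {A : Fin l → Pred (Fin m) 0ℓ} {B : Fin l → Pred (Fin k) 0ℓ}
  (P? : Decidable P) (Q? : Decidable Q) (J? : Decidable J)
  (A? : ∀ r → Decidable (A r)) (B? : ∀ r → Decidable (B r)) →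
  (∀ {x} → P x → ∃ λ r → J r × A r x) →
  (∀ {r} → J r → count (A? r) ≤ count (B? r)) →
  (∀ {i r s} → J r × B r i → J s × B s i → r ≡ s) →
  (∀ {i r} → J r × B r i → Q i) →
  count P? ≤ count Q?
double-counting {m} {k} {l} {J = J} {A} {B} P? Q? J? A? B? cover A≤B unique B⇒Q = begin
  count P?                                     ≤⟨ ∑-mono-≤ (λ x → 𝟙-≤-count (P? x) (JA? x) cover) ⟩
  ∑[ x < m ] count (JA? x)                     ≡⟨ ∑-comm (λ x r → 𝟙 (JA? x r)) ⟩
  ∑[ r < l ] count (λ x → J? r ×-dec A? r x)   ≤⟨ ∑-mono-≤ (λ r → restrict (J? r)) ⟩
  ∑[ r < l ] count (λ i → J? r ×-dec B? r i)   ≡⟨ ∑-comm (λ i r → 𝟙 (JB? i r)) ⟨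
  ∑[ i < k ] count (JB? i)                     ≤⟨ ∑-mono-≤ (λ i → count-≤-𝟙 (JB? i) (Q? i) unique B⇒Q) ⟩
  count Q?                                     ∎
  where
  open ≤-Reasoning
  JA? : ∀ x → Decidable (λ r → J r × A r x)
  JA? x r = J? r ×-dec A? r x
  JB? : ∀ i → Decidable (λ r → J r × B r i)
  JB? i r = J? r ×-dec B? r i
  restrict : ∀ {r} (Jr? : Dec (J r)) → count (λ x → Jr? ×-dec A? r x) ≤ count (λ i → Jr? ×-dec B? r i)
  restrict {r} Jr?@(yes Jr) = begin
    count (λ x → Jr? ×-dec A? r x) ≤⟨ count-mono (λ x → Jr? ×-dec A? r x) (A? r) proj₂ ⟩
    count (A? r)                   ≤⟨ A≤B Jr ⟩
    count (B? r)                   ≤⟨ count-mono (B? r) (λ i → Jr? ×-dec B? r i) (Jr ,_) ⟩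
    count (λ i → Jr? ×-dec B? r i) ∎
  restrict {r} Jr?@(no ¬Jr) =
    ≤-trans (≤-reflexive (count-none (λ x → Jr? ×-dec A? r x) (λ x → ¬Jr ∘ proj₁))) z≤n

choose : {P : Pred (Fin m) 0ℓ} → Decidable P → Fin m → Fin m
choose P? d with Fin.any? P?
... | yes (i , _) = i
... | no _        = d

choose-∃ : {P : Pred (Fin m) 0ℓ} (P? : Decidable P) (d : Fin m) → ∃ P → P (choose P? d)
choose-∃ P? d ∃P with Fin.any? P?
... | yes (_ , Pi) = Pi
... | no ¬∃P       = ⊥-elim (¬∃P ∃P)

choose-preserves : {P : Pred (Fin m) 0ℓ} (R : Pred (Fin m) 0ℓ) (P? : Decidable P) {d : Fin m} →
  (∀ {i} → P i → R i) → R d → R (choose P? d)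
choose-preserves R P? P⇒R Rd with Fin.any? P?
... | yes (_ , Pi) = P⇒R Pi
... | no _         = Rd

module Graph {n : ℕ} (G : SimpleGraph n) where

  open SimpleGraph G using (adj; irrefl)

  infix 4 _∼_
  _∼_ : Fin n → Fin n → Set
  _∼_ = Adj G

  _∼?_ : ∀ u v → Dec (u ∼ v)
  u ∼? v = adj u v Bool.≟ true

  ∼-sym : ∀ {u v} → u ∼ v → v ∼ u
  ∼-sym {u} {v} u∼v = trans (sym (SimpleGraph.sym G u v)) u∼v

  ∼-irrefl : ∀ {u v} → u ∼ v → u ≢ v
  ∼-irrefl {u} u∼u refl with trans (sym u∼u) (irrefl u)
  ... | ()

  Reach : ℕ → Fin n → Fin n → Set
  Reach zero    u v = u ≡ v
  Reach (suc k) u v = u ≡ v ⊎ ∃ λ w → u ∼ w × Reach k w v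

  reach? : ∀ k u v → Dec (Reach k u v)
  reach? zero    u v = u Fin.≟ v
  reach? (suc k) u v = u Fin.≟ v ⊎-dec Fin.any? (λ w → u ∼? w ×-dec reach? k w v)

  Reach-refl : ∀ k {u} → Reach k u u
  Reach-refl zero    = refl
  Reach-refl (suc k) = inj₁ refl

  Reach-mono : ∀ {j k u v} → j ≤ k → Reach j u v → Reach k u v
  Reach-mono {k = k} z≤n refl                     = Reach-refl k
  Reach-mono         (s≤s j≤k) (inj₁ u≡v)         = inj₁ u≡v
  Reach-mono         (s≤s j≤k) (inj₂ (w , a , r)) = inj₂ (w , a , Reach-mono j≤k r)

  Reach-snoc : ∀ k {u w v} → Reach k u w → w ∼ v → Reach (suc k) u v
  Reach-snoc zero    refl               w∼v = inj₂ (_ , w∼v , refl)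
  Reach-snoc (suc k) (inj₁ refl)        w∼v = inj₂ (_ , w∼v , Reach-refl (suc k))
  Reach-snoc (suc k) (inj₂ (x , a , r)) w∼v = inj₂ (x , a , Reach-snoc k r w∼v)

  Walk⇒Reach : ∀ {u v} → Walk G u v → ∃ λ k → Reach k u v
  Walk⇒Reach here            = 0 , refl
  Walk⇒Reach (step u∼w walk) = let k , r = Walk⇒Reach walk in suc k , inj₂ (_ , u∼w , r)

  shortest : ∀ b {u v} → Reach b u v → ∃ λ k → Reach k u v × (∀ {j} → Reach j u v → k ≤ j)
  shortest zero    r = 0 , r , λ _ → z≤n
  shortest (suc b) {u} {v} r with reach? b u v
  ... | yes r′ = shortest b r′
  ... | no ¬r′ = suc b , r , minimal
    where
    minimal : ∀ {j} → Reach j u v → suc b ≤ j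
    minimal {j} rj with suc b ≤? j
    ... | yes b<j = b<j
    ... | no b≮j  = ⊥-elim (¬r′ (Reach-mono (≤-pred (≰⇒> b≮j)) rj))

  Leaf : Fin n → Set
  Leaf x = degree G x ≡ 1

  Leaf? : Decidable Leaf
  Leaf? x = degree G x ≟ 1

  numLeaves≡count : numLeaves G ≡ count Leaf?
  numLeaves≡count = sum-map-allFin (𝟙 ∘ Leaf?)

  degree≡count : ∀ x → degree G x ≡ count (x ∼?_)
  degree≡count x = trans (sum-map-allFin (λ v → if adj x v then 1 else 0)) (sum-cong-≗ 𝟙-∼?)
    where
    𝟙-∼? : ∀ v → (if adj x v then 1 else 0) ≡ 𝟙 (x ∼? v)
    𝟙-∼? v with adj x v
    ... | true  = refl
    ... | false = refl

  leaf-neighbour-unique : ∀ {x a b} → Leaf x → x ∼ a → x ∼ b → a ≡ b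
  leaf-neighbour-unique {x} {a} {b} leaf x∼a x∼b = decidable-stable (a Fin.≟ b) λ a≢b →
    1+n≰n (≤-trans (count-≥2 (x ∼?_) x∼a x∼b a≢b) (≤-reflexive (trans (sym (degree≡count x)) leaf)))

  leaf-has-neighbour : ∀ {x} → Leaf x → ∃ (x ∼_)
  leaf-has-neighbour {x} leaf = decidable-stable (Fin.any? (x ∼?_)) λ ¬∃ →
    0≢1+n (trans (sym (count-none (x ∼?_) (λ v x∼v → ¬∃ (v , x∼v))))
                 (trans (sym (degree≡count x)) leaf))

  non-leaf-other-neighbour : ∀ {x a} → ¬ Leaf x → x ∼ a → ∃ λ b → x ∼ b × b ≢ a
  non-leaf-other-neighbour {x} {a} ¬leaf x∼a =
    decidable-stable (Fin.any? (λ b → x ∼? b ×-dec ¬? (b Fin.≟ a))) λ ¬∃ →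
      ¬leaf (trans (degree≡count x) (≤-antisym
        (count-≤-1 (x ∼?_) (λ x∼b x∼c → trans (only-a ¬∃ x∼b) (sym (only-a ¬∃ x∼c))))
        (count-pos (x ∼?_) x∼a)))
    where
    only-a : ¬ (∃ λ b → x ∼ b × b ≢ a) → ∀ {b} → x ∼ b → b ≡ a
    only-a ¬∃ {b} x∼b = decidable-stable (b Fin.≟ a) (λ b≢a → ¬∃ (b , x∼b , b≢a))

  leaf-neighbour-non-leaf : Connected G → 3 ≤ n → ∀ {x y} → Leaf x → x ∼ y → ¬ Leaf y
  leaf-neighbour-non-leaf connected 3≤n {x} {y} leaf-x x∼y leaf-y =
    let i , j , i<j , same-side = Fin.pigeonhole 3≤n side in Fin.<⇒≢ i<j (side-injective same-side)
    where
    stays : ∀ {u z} → u ≡ x ⊎ u ≡ y → Walk G u z → z ≡ x ⊎ z ≡ y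
    stays u∈xy        here            = u∈xy
    stays (inj₁ refl) (step x∼w walk) = stays (inj₂ (leaf-neighbour-unique leaf-x x∼w x∼y)) walk
    stays (inj₂ refl) (step y∼w walk) = stays (inj₁ (leaf-neighbour-unique leaf-y y∼w (∼-sym x∼y))) walk
    side : Fin n → Fin 2
    side z with stays (inj₁ refl) (connected x z)
    ... | inj₁ _ = zero
    ... | inj₂ _ = suc zero
    side-injective : ∀ {i j} → side i ≡ side j → i ≡ j
    side-injective {i} {j} with stays (inj₁ refl) (connected x i) | stays (inj₁ refl) (connected x j)
    ... | inj₁ refl | inj₁ refl = λ _ → refl
    ... | inj₂ refl | inj₂ refl = λ _ → refl
    ... | inj₁ _    | inj₂ _    = λ ()
    ... | inj₂ _    | inj₁ _    = λ ()

module Distance {n : ℕ} (G : SimpleGraph n) (connected : Connected G) where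

  open Graph G public

  private
    geodesic : ∀ u v → ∃ λ k → Reach k u v × (∀ {j} → Reach j u v → k ≤ j)
    geodesic u v = let k , r = Walk⇒Reach (connected u v) in shortest k r

  dist : Fin n → Fin n → ℕ
  dist u v = proj₁ (geodesic u v)

  dist-Reach : ∀ u v → Reach (dist u v) u v
  dist-Reach u v = proj₁ (proj₂ (geodesic u v))

  dist-minimal : ∀ {k u v} → Reach k u v → dist u v ≤ k
  dist-minimal {u = u} {v} = proj₂ (proj₂ (geodesic u v))

  dist-self : ∀ u → dist u u ≡ 0
  dist-self u = n≤0⇒n≡0 (dist-minimal {0} refl)

  dist≡0⇒≡ : ∀ {u v} → dist u v ≡ 0 → u ≡ v
  dist≡0⇒≡ {u} {v} d≡0 = subst (λ k → Reach k u v) d≡0 (dist-Reach u v)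

  dist-∼ˡ : ∀ {u w} v → u ∼ w → dist u v ≤ suc (dist w v)
  dist-∼ˡ {u} {w} v u∼w = dist-minimal (inj₂ (w , u∼w , dist-Reach w v))

  dist-∼ʳ : ∀ u {w v} → w ∼ v → dist u v ≤ suc (dist u w)
  dist-∼ʳ u {w} w∼v = dist-minimal (Reach-snoc (dist u w) (dist-Reach u w) w∼v)

  dist-∼ : ∀ {u v} → u ∼ v → dist u v ≡ 1
  dist-∼ {u} {v} u∼v = ≤-antisym
    (≤-trans (dist-∼ˡ v u∼v) (≤-reflexive (cong suc (dist-self v))))
    (n≢0⇒n>0 (∼-irrefl u∼v ∘ dist≡0⇒≡))

  dist-bound : ℕ
  dist-bound = sum (λ u → sum (dist u))

  dist≤dist-bound : ∀ u v → dist u v ≤ dist-bound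
  dist≤dist-bound u v = ≤-trans (term≤∑ (dist u) v) (term≤∑ (λ u → sum (dist u)) u)

  -- In a tree, for a fixed neighbour q of a, FirstStep a q is the vertex set of
  -- the component of T - a containing q: the branch at a through q.
  FirstStep : Fin n → Fin n → Fin n → Set
  FirstStep u w v = u ∼ w × suc (dist w v) ≡ dist u v

  FirstStep? : ∀ u w v → Dec (FirstStep u w v)
  FirstStep? u w v = u ∼? w ×-dec (suc (dist w v) ≟ dist u v)

  firstStep⇒≢ : ∀ {u w v} → FirstStep u w v → u ≢ v
  firstStep⇒≢ {v = v} (_ , e) refl = 0≢1+n (trans (sym (dist-self v)) (sym e))

  firstStep-self : ∀ {u w} → u ∼ w → FirstStep u w w
  firstStep-self {u} {w} u∼w = u∼w , trans (cong suc (dist-self w)) (sym (dist-∼ u∼w))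

  firstStep-asym : ∀ {a q x} → FirstStep a q x → ¬ FirstStep q a x
  firstStep-asym {a} {q} {x} (_ , a→q→x) (_ , q→a→x) =
    m≢1+n+m (dist q x) (sym (trans (cong suc a→q→x) q→a→x))

  firstStep-exists : ∀ {u v} → u ≢ v → ∃ λ w → FirstStep u w v
  firstStep-exists {u} {v} u≢v with dist u v in eq | dist-Reach u v
  ... | zero  | u≡v                = ⊥-elim (u≢v u≡v)
  ... | suc k | inj₁ u≡v           = ⊥-elim (u≢v u≡v)
  ... | suc k | inj₂ (w , u∼w , r) = w , u∼w , ≤-antisym
    (s≤s (dist-minimal r)) (≤-trans (≤-reflexive (sym eq)) (dist-∼ˡ v u∼w))

  -- towards u u = u.  Opaque, so that a `with u ≟ v` in later proofs leaves it alone.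
  opaque
    towards : Fin n → Fin n → Fin n
    towards u v with u Fin.≟ v
    ... | yes _  = u
    ... | no u≢v = proj₁ (firstStep-exists u≢v)

    towards-self : ∀ u → towards u u ≡ u
    towards-self u with u Fin.≟ u
    ... | yes _  = refl
    ... | no u≢u = ⊥-elim (u≢u refl)

    towards-firstStep : ∀ {u v} → u ≢ v → FirstStep u (towards u v) v
    towards-firstStep {u} {v} u≢v with u Fin.≟ v
    ... | yes u≡v = ⊥-elim (u≢v u≡v)
    ... | no u≢v′ = proj₂ (firstStep-exists u≢v′)

    towards-legal : ∀ u v → LegalStep G u (towards u v)
    towards-legal u v with u Fin.≟ v
    ... | yes _  = inj₁ refl
    ... | no u≢v = inj₂ (proj₁ (proj₂ (firstStep-exists u≢v)))

  towards-moved : ∀ {u v} → towards u v ≢ u → u ∼ towards u v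
  towards-moved {u} moved = proj₁ (towards-firstStep λ { refl → moved (towards-self u) })

  leaf-branch : ∀ {a q x} → Leaf q → FirstStep a q x → x ≡ q
  leaf-branch {a} {q} {x} leaf a→q→x = decidable-stable (x Fin.≟ q) λ x≢q →
    let q→r→x = towards-firstStep (≢-sym x≢q)
        r≡a   = leaf-neighbour-unique leaf (proj₁ q→r→x) (∼-sym (proj₁ a→q→x))
    in  firstStep-asym a→q→x (subst (λ r → FirstStep q r x) r≡a q→r→x)

module Tree {n : ℕ} (G : SimpleGraph n) (connected : Connected G) (acyclic : ¬ HasCycle G) where

  open Distance G connected public

  Path : Fin n → List (Fin n) → Fin n → Set
  Path a []       c = a ∼ c
  Path a (p ∷ ps) c = a ∼ p × Path p ps c

  Path-snoc : ∀ {a c d} ps → Path a ps c → c ∼ d → Path a (ps ++ c ∷ []) d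
  Path-snoc []       a∼c          c∼d = a∼c , c∼d
  Path-snoc (p ∷ ps) (a∼p , path) c∼d = a∼p , Path-snoc ps path c∼d

  Path⇒IsPath : ∀ {a c} ps → Path a ps c → IsPath G (a ∷ ps ++ c ∷ [])
  Path⇒IsPath []       a∼c          = a∼c , tt
  Path⇒IsPath (p ∷ ps) (a∼p , path) = a∼p , Path⇒IsPath ps path

  -- Walking both ends towards v until the two walks meet would close a cycle.
  no-level-detour : ∀ h {v a₁ a₂} ps → a₁ ≢ a₂ → dist a₁ v ≡ h → dist a₂ v ≡ h →
    Path a₁ ps a₂ → Unique (a₁ ∷ ps ++ a₂ ∷ []) → All (λ z → h ≤ dist z v) ps → ⊥
  no-level-detour zero    ps a₁≢a₂ d₁ d₂ _ _ _ = a₁≢a₂ (trans (dist≡0⇒≡ d₁) (sym (dist≡0⇒≡ d₂)))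
  no-level-detour (suc h) {v} {a₁} {a₂} ps a₁≢a₂ d₁ d₂ path unique far = meet (b₁ Fin.≟ b₂)
    where
    ≢v : ∀ {a} → dist a v ≡ suc h → a ≢ v
    ≢v d refl = 0≢1+n (trans (sym (dist-self v)) d)
    b₁ = towards a₁ v
    b₂ = towards a₂ v
    a₁→b₁ : FirstStep a₁ b₁ v
    a₁→b₁ = towards-firstStep (≢v d₁)
    a₂→b₂ : FirstStep a₂ b₂ v
    a₂→b₂ = towards-firstStep (≢v d₂)
    e₁ : dist b₁ v ≡ h
    e₁ = suc-injective (trans (proj₂ a₁→b₁) d₁)
    e₂ : dist b₂ v ≡ h
    e₂ = suc-injective (trans (proj₂ a₂→b₂) d₂)
    S = a₁ ∷ ps ++ a₂ ∷ []
    S-far : All (λ z → suc h ≤ dist z v) S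
    S-far = ≤-reflexive (sym d₁) ∷ All.++⁺ far (≤-reflexive (sym d₂) ∷ [])
    ∉S : ∀ {b} → dist b v ≡ h → All (b ≢_) S
    ∉S d = All.map (λ h<z → λ { refl → 1+n≰n (≤-trans h<z (≤-reflexive d)) }) S-far
    path-S : ∀ {b} → a₂ ∼ b → Path b₁ S b
    path-S a₂∼b = ∼-sym (proj₁ a₁→b₁) , Path-snoc ps path a₂∼b
    meet : Dec (b₁ ≡ b₂) → ⊥
    meet (yes b₁≡b₂) = acyclic (b₁ , S , 2≤|S| , ∉S e₁ ∷ unique ,
      Path⇒IsPath S (path-S (subst (a₂ ∼_) (sym b₁≡b₂) (proj₁ a₂→b₂))))
      where
      2≤|S| : 2 ≤ length S
      2≤|S| = s≤s (subst (1 ≤_) (sym (length-++ ps)) (m≤n+m 1 (length ps)))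
    meet (no b₁≢b₂) = no-level-detour h S b₁≢b₂ e₁ e₂ (path-S (proj₁ a₂→b₂))
      (All.++⁺ (∉S e₁) (b₁≢b₂ ∷ []) ∷
       AllPairs.++⁺ unique ([] ∷ []) (All.map (λ b₂≢z → ≢-sym b₂≢z ∷ []) (∉S e₂)))
      (All.map (≤-trans (n≤1+n h)) S-far)

  firstStep-unique : ∀ {x y₁ y₂ v} → FirstStep x y₁ v → FirstStep x y₂ v → y₁ ≡ y₂
  firstStep-unique {x} {y₁} {y₂} {v} (x∼y₁ , e₁) (x∼y₂ , e₂) =
    decidable-stable (y₁ Fin.≟ y₂) λ y₁≢y₂ →
      no-level-detour (dist y₁ v) (x ∷ []) y₁≢y₂ refl (suc-injective (trans e₂ (sym e₁)))
        (∼-sym x∼y₁ , x∼y₂)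
        ((≢-sym (∼-irrefl x∼y₁) ∷ y₁≢y₂ ∷ []) ∷ (∼-irrefl x∼y₂ ∷ []) ∷ [] ∷ [])
        (≤-trans (n≤1+n _) (≤-reflexive e₁) ∷ [])

  towards-unique : ∀ {x y v} → FirstStep x y v → y ≡ towards x v
  towards-unique first = firstStep-unique first (towards-firstStep (firstStep⇒≢ first))

  adjacent-firstStep : ∀ {x y} v → x ∼ y → FirstStep x y v ⊎ FirstStep y x v
  adjacent-firstStep {x} {y} v x∼y with <-cmp (dist x v) (dist y v)
  ... | tri< x<y _ _ = inj₂ (∼-sym x∼y , ≤-antisym x<y (dist-∼ˡ v (∼-sym x∼y)))
  ... | tri> _ _ y<x = inj₁ (x∼y , ≤-antisym y<x (dist-∼ˡ v x∼y))
  ... | tri≈ _ x≡y _ = ⊥-elim (no-level-detour (dist x v) [] (∼-irrefl x∼y) refl (sym x≡y) x∼y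
                         ((∼-irrefl x∼y ∷ []) ∷ [] ∷ []) [])

  firstStep-∼ : ∀ {b r p p′} → FirstStep b r p → p ∼ p′ → b ≢ p′ → FirstStep b r p′
  firstStep-∼ {b} {r} {p} {p′} b→r→p@(b∼r , r→p) p∼p′ b≢p′ =
    [ id , ⊥-elim ∘ away ]′ (adjacent-firstStep p′ b∼r)
    where
    s = towards b p′
    b→s→p′ : FirstStep b s p′
    b→s→p′ = towards-firstStep b≢p′
    away : FirstStep r b p′ → ⊥
    away r→b→p′ with adjacent-firstStep p (proj₁ b→s→p′)
    ... | inj₁ b→s→p =
      firstStep-asym b→s→p′ (subst (λ z → FirstStep z b p′) (firstStep-unique b→r→p b→s→p) r→b→p′)
    ... | inj₂ (_ , b→p-via-s) = 1+n≰n (≤-trans (n≤1+n _) (begin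
      suc (suc (dist r p)) ≡⟨ cong suc r→p ⟩
      suc (dist b p)       ≡⟨ b→p-via-s ⟩
      dist s p             ≤⟨ dist-∼ʳ s (∼-sym p∼p′) ⟩
      suc (dist s p′)      ≡⟨ proj₂ b→s→p′ ⟩
      dist b p′            ≤⟨ ≤-pred (≤-trans (≤-reflexive (proj₂ r→b→p′)) (dist-∼ʳ r p∼p′)) ⟩
      dist r p             ∎))
      where open ≤-Reasoning

  towards-resp-∼ : ∀ {b p p′} → p ∼ p′ → b ≢ p → b ≢ p′ → towards b p ≡ towards b p′
  towards-resp-∼ p∼p′ b≢p b≢p′ = towards-unique (firstStep-∼ (towards-firstStep b≢p) p∼p′ b≢p′)

  two-steps : ∀ {b p p′} → b ∼ p → p ∼ p′ → b ≢ p′ → FirstStep b p p′ × ¬ b ∼ p′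
  two-steps {b} {p} {p′} b∼p p∼p′ b≢p′ with adjacent-firstStep p′ b∼p
  ... | inj₂ p→b→p′ = ⊥-elim (b≢p′ (firstStep-unique p→b→p′ (firstStep-self p∼p′)))
  ... | inj₁ b→p→p′ = b→p→p′ , λ b∼p′ →
    1+n≢n (trans (cong suc (sym (dist-∼ p∼p′))) (trans (proj₂ b→p→p′) (dist-∼ b∼p′)))

  firstStep-nested : ∀ {a q r v} → q ∼ a → r ≢ a → FirstStep q r v → FirstStep a q v
  firstStep-nested {v = v} q∼a r≢a q→r→v with adjacent-firstStep v q∼a
  ... | inj₁ q→a→v = ⊥-elim (r≢a (firstStep-unique q→r→v q→a→v))
  ... | inj₂ a→q→v = a→q→v

  firstStep-legal : ∀ {a q r u v} → q ∼ a → r ≢ a → FirstStep q r v → LegalStep G u v →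
    FirstStep a q u
  firstStep-legal q∼a r≢a q→r→v (inj₁ refl) = firstStep-nested q∼a r≢a q→r→v
  firstStep-legal {q = q} {u = u} q∼a r≢a q→r→v (inj₂ u∼v) with u Fin.≟ q
  ... | yes refl = firstStep-self (∼-sym q∼a)
  ... | no u≢q   = firstStep-nested q∼a r≢a (firstStep-∼ q→r→v (∼-sym u∼v) (≢-sym u≢q))

  branchSize : Fin n → Fin n → ℕ
  branchSize a q = count (FirstStep? a q)

  branchSize-nested : ∀ {a q r} → q ∼ a → r ≢ a → branchSize q r < branchSize a q
  branchSize-nested q∼a r≢a =
    count-mono-< (FirstStep? _ _) (FirstStep? _ _) (firstStep-nested q∼a r≢a)
      (firstStep-self (∼-sym q∼a)) (λ q→r→q → firstStep⇒≢ q→r→q refl)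

  branch-has-leaf : ∀ {a q} → a ∼ q → ∃ λ x → Leaf x × FirstStep a q x
  branch-has-leaf = search _ ≤-refl
    where
    search : ∀ k {a q} → branchSize a q ≤ k → a ∼ q → ∃ λ x → Leaf x × FirstStep a q x
    search k {a} {q} size≤k a∼q with Leaf? q
    ... | yes leaf = q , leaf , firstStep-self a∼q
    ... | no ¬leaf with non-leaf-other-neighbour ¬leaf (∼-sym a∼q) | k
    ...   | _ , _ , _ | zero =
      ⊥-elim (1+n≰n (≤-trans (count-pos (FirstStep? a q) (firstStep-self a∼q)) size≤k))
    ...   | r , q∼r , r≢a | suc k =
      let x , leaf , q→r→x = search k (≤-pred (≤-trans (branchSize-nested (∼-sym a∼q) r≢a) size≤k)) q∼r
      in  x , leaf , firstStep-nested (∼-sym a∼q) r≢a q→r→x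

module Bodyguards {n : ℕ} (G : SimpleGraph n) (connected : Connected G) (acyclic : ¬ HasCycle G) where

  open Tree G connected acyclic

  -- The move of the bodyguard assigned to x, standing at b, while the president is at p.
  opaque
    chase : Fin n → Fin n → Fin n → Fin n
    chase x b p with b Fin.≟ p | b ∼? p
    ... | yes _ | _     = towards p x
    ... | no _  | yes _ = b
    ... | no _  | no _  = towards b p

    chase-at : ∀ x p → chase x p p ≡ towards p x
    chase-at x p with p Fin.≟ p
    ... | yes _  = refl
    ... | no p≢p = ⊥-elim (p≢p refl)

    chase-∼ : ∀ x {b p} → b ≢ p → b ∼ p → chase x b p ≡ b
    chase-∼ x {b} {p} b≢p b∼p with b Fin.≟ p | b ∼? p
    ... | yes b≡p | _      = ⊥-elim (b≢p b≡p)
    ... | no _    | yes _  = refl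
    ... | no _    | no b≁p = ⊥-elim (b≁p b∼p)

    chase-≁ : ∀ x {b p} → b ≢ p → ¬ b ∼ p → chase x b p ≡ towards b p
    chase-≁ x {b} {p} b≢p b≁p with b Fin.≟ p | b ∼? p
    ... | yes b≡p | _       = ⊥-elim (b≢p b≡p)
    ... | no _    | yes b∼p = ⊥-elim (b≁p b∼p)
    ... | no _    | no _    = refl

    chase-legal : ∀ x b p → LegalStep G b (chase x b p)
    chase-legal x b p with b Fin.≟ p | b ∼? p
    ... | yes refl | _     = towards-legal b x
    ... | no _     | yes _ = inj₁ refl
    ... | no _     | no _  = towards-legal b p

  chase-keeps-guarding : ∀ x {p p′} → LegalStep G p p′ → chase x (towards p x) p′ ≡ towards p′ x
  chase-keeps-guarding x {p} (inj₁ refl) = stay (towards p x Fin.≟ p)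
    where
    stay : Dec (towards p x ≡ p) → chase x (towards p x) p ≡ towards p x
    stay (yes g≡p) = subst (λ b → chase x b p ≡ b) (sym g≡p) (trans (chase-at x p) g≡p)
    stay (no g≢p)  = chase-∼ x g≢p (∼-sym (towards-moved g≢p))
  chase-keeps-guarding x {p} {p′} (inj₂ p∼p′) = follow (g Fin.≟ p′)
    where
    g = towards p x
    follow : Dec (g ≡ p′) → chase x g p′ ≡ towards p′ x
    follow (yes g≡p′) = subst (λ b → chase x b p′ ≡ towards p′ x) (sym g≡p′) (chase-at x p′)
    follow (no g≢p′) with adjacent-firstStep x p∼p′
    ... | inj₁ p→p′→x = ⊥-elim (g≢p′ (sym (towards-unique p→p′→x)))
    ... | inj₂ p′→p→x = trans (chase-to-p (g Fin.≟ p)) (towards-unique p′→p→x)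
      where
      chase-to-p : Dec (g ≡ p) → chase x g p′ ≡ p
      chase-to-p (yes g≡p) = trans (chase-∼ x g≢p′ (subst (_∼ p′) (sym g≡p) p∼p′)) g≡p
      chase-to-p (no g≢p)  =
        let g→p→p′ , g≁p′ = two-steps (∼-sym (towards-moved g≢p)) p∼p′ g≢p′
        in  trans (chase-≁ x g≢p′ g≁p′) (sym (towards-unique g→p→p′))

  -- In a tree, Between x b p says that b lies on the path from x to p.
  Between : Fin n → Fin n → Fin n → Set
  Between x b p = b ≡ x ⊎ b ≡ p ⊎ towards b p ≢ towards b x

  between-∼ : ∀ {x b p} → Between x b p → b ≢ p → b ∼ p → b ≡ towards p x
  between-∼ {x} {b} {p} between b≢p b∼p = towards-unique (p→b→x between (adjacent-firstStep x b∼p))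
    where
    p→b→x : Between x b p → FirstStep b p x ⊎ FirstStep p b x → FirstStep p b x
    p→b→x (inj₁ refl)         _            = firstStep-self (∼-sym b∼p)
    p→b→x (inj₂ (inj₁ b≡p))   _            = ⊥-elim (b≢p b≡p)
    p→b→x (inj₂ (inj₂ apart)) (inj₁ b→p→x) =
      ⊥-elim (apart (trans (sym (towards-unique (firstStep-self b∼p))) (towards-unique b→p→x)))
    p→b→x (inj₂ (inj₂ _))     (inj₂ p→b→x) = p→b→x

  between-≁ : ∀ {x b p} → Between x b p → b ≢ p → ¬ b ∼ p →
    FirstStep (towards b p) b x × ∀ {p′} → LegalStep G p p′ → Between x (towards b p) p′
  between-≁ {x} {b} {p} between b≢p b≁p = away , stays
    where
    b′ = towards b p
    b→b′→p : FirstStep b b′ p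
    b→b′→p = towards-firstStep b≢p
    b′≢p : b′ ≢ p
    b′≢p b′≡p = b≁p (subst (b ∼_) b′≡p (proj₁ b→b′→p))
    away′ : Between x b p → FirstStep b b′ x ⊎ FirstStep b′ b x → FirstStep b′ b x
    away′ _                   (inj₂ b′→b→x) = b′→b→x
    away′ (inj₁ b≡x)          (inj₁ b→b′→x) = ⊥-elim (firstStep⇒≢ b→b′→x b≡x)
    away′ (inj₂ (inj₁ b≡p))   (inj₁ _)      = ⊥-elim (b≢p b≡p)
    away′ (inj₂ (inj₂ apart)) (inj₁ b→b′→x) = ⊥-elim (apart (towards-unique b→b′→x))
    away : FirstStep b′ b x
    away = away′ between (adjacent-firstStep x (proj₁ b→b′→p))
    not-back : towards b′ p ≢ b
    not-back back = firstStep-asym b→b′→p (subst (λ w → FirstStep b′ w p) back (towards-firstStep b′≢p))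
    stays : ∀ {p′} → LegalStep G p p′ → Between x b′ p′
    stays {p′} legal with b′ Fin.≟ p′
    ... | yes b′≡p′ = inj₂ (inj₁ b′≡p′)
    ... | no b′≢p′  = inj₂ (inj₂ λ same →
      not-back (trans (towards-p legal) (trans same (sym (towards-unique away)))))
      where
      towards-p : LegalStep G p p′ → towards b′ p ≡ towards b′ p′
      towards-p (inj₁ refl) = refl
      towards-p (inj₂ p∼p′) = towards-resp-∼ p∼p′ b′≢p b′≢p′

  chase-progress : ∀ {x b p} → Between x b p →
    chase x b p ≡ towards p x ⊎
    (FirstStep (chase x b p) b x × ∀ {p′} → LegalStep G p p′ → Between x (chase x b p) p′)
  chase-progress {x} {b} {p} between with b Fin.≟ p | b ∼? p
  ... | yes refl | _       = inj₁ (chase-at x b)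
  ... | no b≢p   | yes b∼p = inj₁ (trans (chase-∼ x b≢p b∼p) (between-∼ between b≢p b∼p))
  ... | no b≢p   | no b≁p  rewrite chase-≁ x b≢p b≁p = inj₂ (between-≁ between b≢p b≁p)

  strategy : ∀ {k} → (Fin k → Fin n) → BStrategy G k
  strategy guard = record
    { start = guard
    ; move  = λ c p _ i → chase (guard i) (c i) p
    ; legal = λ c p _ i → chase-legal (guard i) (c i) p
    }

  module Play {k} (guard : Fin k → Fin n) (τ : PStrategy G k) where

    c : ℕ → Conf G k
    c = bodyguardsAt G (strategy guard) τ

    president : ℕ → Fin n
    president = presidentAt G (strategy guard) τ

    president-legal : ∀ t → LegalStep G (president t) (president (suc t))
    president-legal t = PStrategy.legal τ _ _ _ _

    Guarding : Fin k → ℕ → Set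
    Guarding i t = c (suc t) i ≡ towards (president t) (guard i)

    guarding-persists : ∀ i t → Guarding i t → Guarding i (suc t)
    guarding-persists i t guarding =
      subst (λ b → chase (guard i) b (president (suc t)) ≡ towards (president (suc t)) (guard i))
        (sym guarding) (chase-keeps-guarding (guard i) (president-legal t))

    guarding-or-advancing : ∀ i t → Guarding i t ⊎
      (Between (guard i) (c (suc t) i) (president (suc t)) × t < dist (c (suc t) i) (guard i))
    guarding-or-advancing i zero with chase-progress (inj₁ refl)
    ... | inj₁ guarding               = inj₁ guarding
    ... | inj₂ (away , stays-between) =
      inj₂ (stays-between (president-legal 0) , ≤-trans (s≤s z≤n) (≤-reflexive (proj₂ away)))
    guarding-or-advancing i (suc t) with guarding-or-advancing i t
    ... | inj₁ guarding        = inj₁ (guarding-persists i t guarding)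
    ... | inj₂ (between , t<d) with chase-progress between
    ...   | inj₁ guarding               = inj₁ guarding
    ...   | inj₂ (away , stays-between) =
      inj₂ (stays-between (president-legal (suc t)) , ≤-trans (s≤s t<d) (≤-reflexive (proj₂ away)))

    guarding-eventually : ∀ i d → Guarding i (d + dist-bound)
    guarding-eventually i zero with guarding-or-advancing i dist-bound
    ... | inj₁ guarding  = guarding
    ... | inj₂ (_ , D<d) = ⊥-elim (<⇒≱ D<d (dist≤dist-bound _ _))
    guarding-eventually i (suc d) = guarding-persists i (d + dist-bound) (guarding-eventually i d)

    module _ (covers : ∀ {x} → Leaf x → ∃ λ i → guard i ≡ x) where

      surrounded : ∀ t → (∀ i → Guarding i t) → Surrounded G (c (suc t)) (president t)
      surrounded t guarding u p∼u =
        let x , leaf , p→u→x = branch-has-leaf p∼u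
            i , i↦x          = covers leaf
        in  i , (begin
          c (suc t) i                     ≡⟨ guarding i ⟩
          towards (president t) (guard i) ≡⟨ cong (towards (president t)) i↦x ⟩
          towards (president t) x         ≡⟨ towards-unique p→u→x ⟨
          u                               ∎)
        where open ≡-Reasoning

      wins : BodyguardsWinPlay G (strategy guard) τ
      wins = dist-bound , λ t D≤t → surrounded t λ i →
        subst (Guarding i) (m∸n+n≡m D≤t) (guarding-eventually i (t ∸ dist-bound))

  covering-bodyguards-win : ∀ {k} (guard : Fin k → Fin n) → (∀ {x} → Leaf x → ∃ λ i → guard i ≡ x) →
    BodyguardsWin G k
  covering-bodyguards-win guard covers = strategy guard , λ τ → Play.wins guard τ covers

  numLeaves-bodyguards-win : BodyguardsWin G (numLeaves G)
  numLeaves-bodyguards-win = subst (BodyguardsWin G) (length-filter Leaf? (allFin n))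
    (covering-bodyguards-win (lookup leaves) covers)
    where
    leaves = filter Leaf? (allFin n)
    covers : ∀ {x} → Leaf x → ∃ λ i → lookup leaves i ≡ x
    covers {x} leaf = let x∈leaves = ∈-filter⁺ Leaf? (∈-allFin x) leaf in
      Any.index x∈leaves , sym (Any.lookup-index x∈leaves)

module President {n : ℕ} (G : SimpleGraph n) (connected : Connected G) (acyclic : ¬ HasCycle G) (k : ℕ) where

  open Tree G connected acyclic

  guardsIn : Conf G k → Fin n → Fin n → ℕ
  guardsIn c a q = count (λ i → FirstStep? a q (c i))

  leavesIn : Fin n → Fin n → ℕ
  leavesIn a q = count (λ x → Leaf? x ×-dec FirstStep? a q x)

  Escape : Conf G k → Fin n → Fin n → Set
  Escape c a q = a ∼ q × guardsIn c a q < leavesIn a q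

  Escape? : ∀ c a q → Dec (Escape c a q)
  Escape? c a q = a ∼? q ×-dec guardsIn c a q <? leavesIn a q

  escape-exists : k < numLeaves G → ∀ c {p} → ¬ Leaf p → ∃ (Escape c p)
  escape-exists k<ℓ c {p} ¬leaf = decidable-stable (Fin.any? (Escape? c p)) λ ¬escape →
    <⇒≱ k<ℓ (begin
      numLeaves G ≡⟨ numLeaves≡count ⟩
      count Leaf? ≤⟨ double-counting Leaf? all? (p ∼?_)
                       (λ q x → Leaf? x ×-dec FirstStep? p q x) (λ q i → FirstStep? p q (c i))
                       cover (λ p∼q → ≮⇒≥ (λ few → ¬escape (_ , p∼q , few)))
                       (λ (_ , p→q) (_ , p→s) → firstStep-unique p→q p→s) (λ _ → tt) ⟩
      count all?  ≤⟨ count-≤ all? ⟩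
      k           ∎)
    where
    open ≤-Reasoning
    all? : Decidable {A = Fin k} (λ _ → ⊤)
    all? _ = yes tt
    cover : ∀ {x} → Leaf x → ∃ λ q → p ∼ q × Leaf x × FirstStep p q x
    cover leaf = let p→q→x = towards-firstStep (λ { refl → ¬leaf leaf }) in
      _ , proj₁ p→q→x , leaf , p→q→x

  escape-continues : ∀ {c c′ a q} → LegalConfStep G c c′ → Surrounded G c a → Escape c a q →
    ∃ λ r → Escape c′ q r × r ≢ a
  escape-continues {c} {c′} {a} {q} legal surrounded (a∼q , few) with Leaf? q
  ... | yes leaf = let i , cᵢ≡q = surrounded q a∼q in ⊥-elim (<⇒≱ few (begin
    leavesIn a q   ≤⟨ count-≤-1 (λ x → Leaf? x ×-dec FirstStep? a q x)
                        (λ (_ , a→x) (_ , a→y) → trans (leaf-branch leaf a→x) (sym (leaf-branch leaf a→y))) ⟩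
    1              ≤⟨ count-pos (λ i → FirstStep? a q (c i))
                        (subst (FirstStep a q) (sym cᵢ≡q) (firstStep-self a∼q)) ⟩
    guardsIn c a q ∎))
    where open ≤-Reasoning
  ... | no ¬leaf = decidable-stable (Fin.any? (λ r → Escape? c′ q r ×-dec ¬? (r Fin.≟ a))) λ ¬escape →
    <⇒≱ few (double-counting (λ x → Leaf? x ×-dec FirstStep? a q x) (λ i → FirstStep? a q (c i))
      (λ r → q ∼? r ×-dec ¬? (r Fin.≟ a))
      (λ r x → Leaf? x ×-dec FirstStep? q r x) (λ r i → FirstStep? q r (c′ i))
      cover (λ (q∼r , r≢a) → ≮⇒≥ (λ few′ → ¬escape (_ , (q∼r , few′) , r≢a)))
      (λ (_ , q→r) (_ , q→s) → firstStep-unique q→r q→s)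
      (λ {i} ((_ , r≢a) , q→r→c′ᵢ) → firstStep-legal (∼-sym a∼q) r≢a q→r→c′ᵢ (legal i)))
    where
    cover : ∀ {x} → Leaf x × FirstStep a q x → ∃ λ r → (q ∼ r × r ≢ a) × Leaf x × FirstStep q r x
    cover {x} (leaf , a→q→x) =
      let q→r→x = towards-firstStep {q} {x} (λ { refl → ¬leaf leaf })
          r≢a r≡a = firstStep-asym a→q→x (subst (λ r → FirstStep q r x) r≡a q→r→x)
      in  _ , (proj₁ q→r→x , r≢a) , leaf , q→r→x

  flee : Conf G k → Fin n → Fin n → Fin n
  flee c p previous = choose forward? (choose (Escape? c p) (choose (p ∼?_) p))
    where
    forward? : Decidable (λ q → Escape c p q × q ≢ previous)
    forward? q = Escape? c p q ×-dec ¬? (q Fin.≟ previous)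

  flee-legal : ∀ c p previous → LegalStep G p (flee c p previous)
  flee-legal c p previous = choose-preserves (LegalStep G p) _ (inj₂ ∘ proj₁ ∘ proj₁)
    (choose-preserves (LegalStep G p) _ (inj₂ ∘ proj₁) (choose-preserves (LegalStep G p) _ inj₂ (inj₁ refl)))

  flee-forward : ∀ c p previous → (∃ λ q → Escape c p q × q ≢ previous) →
    Escape c p (flee c p previous) × flee c p previous ≢ previous
  flee-forward c p previous = choose-∃ _ _

  flee-escapes : ∀ c p previous → ∃ (Escape c p) → Escape c p (flee c p previous)
  flee-escapes c p previous ∃escape = choose-preserves (Escape c p) _ proj₁ (choose-∃ _ _ ∃escape)

  flee-moves : ∀ c p previous → ∃ (p ∼_) → p ∼ flee c p previous
  flee-moves c p previous ∃neighbour = choose-preserves (p ∼_) _ (proj₁ ∘ proj₁)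
    (choose-preserves (p ∼_) _ proj₁ (choose-∃ _ _ ∃neighbour))

  previous : Fin n → History G k → Fin n
  previous p []             = p
  previous p ((_ , p₀) ∷ _) = p₀

  strategy : Fin n → PStrategy G k
  strategy v₀ = record
    { place = λ _ → v₀
    ; move  = λ _ p h c′ → flee c′ p (previous p h)
    ; legal = λ _ p h c′ → flee-legal c′ p (previous p h)
    }

  module Play (σ : BStrategy G k) (v₀ : Fin n) where

    c : ℕ → Conf G k
    c = bodyguardsAt G σ (strategy v₀)

    president : ℕ → Fin n
    president = presidentAt G σ (strategy v₀)

    Fleeing : ℕ → Set
    Fleeing t = Escape (c (suc t)) (president t) (president (suc t))

    fleeing-starts : k < numLeaves G → ∀ t → ¬ Leaf (president t) → Fleeing t
    fleeing-starts k<ℓ t ¬leaf = flee-escapes _ _ _ (escape-exists k<ℓ (c (suc t)) ¬leaf)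

    fleeing-continues : ∀ t → Surrounded G (c (suc t)) (president t) → Fleeing t →
      Fleeing (suc t) ×
      branchSize (president (suc t)) (president (suc (suc t))) < branchSize (president t) (president (suc t))
    fleeing-continues t surrounded fleeing =
      let fleeing′ , forward =
            flee-forward _ _ _ (escape-continues (BStrategy.legal σ _ _ _) surrounded fleeing)
      in  fleeing′ , branchSize-nested (∼-sym (proj₁ fleeing)) forward

    module _ (k<ℓ : k < numLeaves G) (3≤n : 3 ≤ n) (T : ℕ)
             (surrounded : ∀ t → T ≤ t → Surrounded G (c (suc t)) (president t)) where

      fleeing-eventually : ∃ λ t → T ≤ t × Fleeing t
      fleeing-eventually with Leaf? (president T)
      ... | no ¬leaf = T , ≤-refl , fleeing-starts k<ℓ T ¬leaf
      ... | yes leaf = suc T , n≤1+n T , fleeing-starts k<ℓ (suc T)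
        (leaf-neighbour-non-leaf connected 3≤n leaf (flee-moves _ _ _ (leaf-has-neighbour leaf)))

      flight-ends : ∀ s t → T ≤ t → Fleeing t → branchSize (president t) (president (suc t)) ≤ s → ⊥
      flight-ends zero    t _   fleeing size≤0 =
        1+n≰n (≤-trans (count-pos (FirstStep? _ _) (firstStep-self (proj₁ fleeing))) size≤0)
      flight-ends (suc s) t T≤t fleeing size≤1+s =
        let fleeing′ , smaller = fleeing-continues t (surrounded t T≤t) fleeing
        in  flight-ends s (suc t) (m≤n⇒m≤1+n T≤t) fleeing′ (≤-pred (≤-trans smaller size≤1+s))

      contradiction : ⊥
      contradiction = let t , T≤t , fleeing = fleeing-eventually in flight-ends _ t T≤t fleeing ≤-refl

  escapes : k < numLeaves G → 3 ≤ n → ¬ BodyguardsWin G k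
  escapes k<ℓ 3≤n (σ , wins) = let T , surrounded = wins (strategy v₀) in
    Play.contradiction σ v₀ k<ℓ 3≤n T surrounded
    where
    v₀ = fromℕ< 3≤n

theorem3p3 : (n : ℕ) (T : SimpleGraph n) → 3 ≤ n → IsTree T →
    IsBodyguardNumber T (numLeaves T)
theorem3p3 n T 3≤n (connected , acyclic) =
  Bodyguards.numLeaves-bodyguards-win T connected acyclic ,
  λ k k<ℓ → President.escapes T connected acyclic k k<ℓ 3≤n
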